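{- Let $k\ge4$ be a power of $2$ and let $\bar b=\langle b_1,\dots,b_k\rangle\in\mathbb N^k$ be v-shape s-dominating at point $i$ (for some $i$). Then $\langle b_1,\dots,b_{k/4}\rangle\succeq\langle b_{k/2+1},\dots,b_{3k/4}\rangle$.
   Context: $\bar b$ is v-shaped if $b_1\ge\dots\ge b_p\le b_{p+1}\le\dots\le b_k$ for some $p$. $\bar b$ is s-dominating if $b_j\ge b_{k-j+1}$ for all $1\le j\le k/2$. A v-shaped s-dominating $\bar b$ is v-shape s-dominating at point $i$ if $i$ is the smallest index greater than $k/2$ with $b_i<b_{i+1}$, or $i=k$ if $\bar b$ is nonincreasing. For sequences, $\bar x\succeq\bar y$ means every entry of $\bar x$ is $\ge$ every entry of $\bar y$. -}

module Defs where

open import Data.Nat using (ℕ; zero; suc; _+_; _*_; _∸_; _^_; _≤_; _<_; _≥_)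
open import Data.Vec using (Vec; []; _∷_)
open import Data.Product using (_×_; ∃-syntax)
open import Data.Sum using (_⊎_)
open import Relation.Nullary using (¬_)
open import Relation.Binary.PropositionalEquality using (_≡_)

-- 1-based access b_j to a tuple b = ⟨b_1,…,b_k⟩ ∈ ℕ^k.
-- (Out-of-range indices return 0, but every predicate below only uses
-- indices 1 ≤ j ≤ k.)
at : ∀ {k} → Vec ℕ k → ℕ → ℕ
at []       _             = 0
at (x ∷ xs) zero          = 0
at (x ∷ xs) (suc zero)    = x
at (x ∷ xs) (suc (suc n)) = at xs (suc n)

IsPowerOf2 : ℕ → Set
IsPowerOf2 k = ∃[ m ] k ≡ 2 ^ m

VShaped : ∀ k → Vec ℕ k → Set
VShaped k b = ∃[ p ] (1 ≤ p × p ≤ k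
  × (∀ j → 1 ≤ j → j < p → at b (suc j) ≤ at b j)
  × (∀ j → p ≤ j → j < k → at b j ≤ at b (suc j)))

SDominating : ∀ k → Vec ℕ k → Set
SDominating k b = ∀ j → 1 ≤ j → 2 * j ≤ k → at b ((k ∸ j) + 1) ≤ at b j

Nonincreasing : ∀ k → Vec ℕ k → Set
Nonincreasing k b = ∀ j → 1 ≤ j → j < k → at b (suc j) ≤ at b j

SmallestAscentAfterHalf : ∀ k → Vec ℕ k → ℕ → Set
SmallestAscentAfterHalf k b i =
  k < 2 * i × i < k × at b i < at b (suc i)
  × (∀ j → k < 2 * j → j < i → ¬ (at b j < at b (suc j)))

VShapeSDominatingAt : ∀ k → Vec ℕ k → ℕ → Set
VShapeSDominatingAt k b i =
  VShaped k b × SDominating k b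
  × (SmallestAscentAfterHalf k b i ⊎ (i ≡ k × Nonincreasing k b))

-- A v-shaped sequence is quasiconvex: each entry is at most the larger of any
-- two entries enclosing it.  For 1 ≤ j ≤ m ≤ k/2 this gives
-- b_m ≤ b_j ⊔ b_{k-j+1} = b_j, and s-domination gives b_{k-m+1} ≤ b_m.  When k
-- is even, the mirror m = k-l+1 of an index l of the third quarter lies in the
-- first half, after every index j of the first quarter.
module Submission where

open import Defs
open import Data.Nat using (ℕ; zero; suc; _+_; _*_; _∸_; _^_; _≤_; _<_; _≥_; _≤′_; ≤′-refl; ≤′-step; _⊔_; z≤n; s≤s)
open import Data.Nat.Properties
open import Data.Vec using (Vec)
open import Data.Product using (_,_; ∃-syntax)
open import Data.Sum using (inj₁; inj₂)
open import Function using (flip)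
open import Relation.Binary.Core using (Rel)
open import Relation.Binary.Definitions using (Reflexive; Transitive)
open import Relation.Binary.PropositionalEquality using (_≡_; refl; sym; cong; subst; module ≡-Reasoning)

stepwise⇒mono : ∀ {a} {A : Set a} {r} (R : Rel A r) → Reflexive R → Transitive R
  → ∀ {f : ℕ → A} {lo hi} → (∀ n → lo ≤ n → n < hi → R (f n) (f (suc n)))
  → ∀ {m n} → lo ≤ m → m ≤′ n → n ≤ hi → R (f m) (f n)
stepwise⇒mono R refl′ trans′ step lo≤m ≤′-refl n≤hi = refl′
stepwise⇒mono R refl′ trans′ step lo≤m (≤′-step {n} m≤′n) 1+n≤hi =
  trans′ (stepwise⇒mono R refl′ trans′ step lo≤m m≤′n (<⇒≤ 1+n≤hi))
         (step n (≤-trans lo≤m (≤′⇒≤ m≤′n)) 1+n≤hi)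

vShaped⇒quasiconvex : ∀ {k} (b : Vec ℕ k) {a c d} → VShaped k b
  → 1 ≤ a → a ≤ c → c ≤ d → d ≤ k → at b c ≤ at b a ⊔ at b d
vShaped⇒quasiconvex b {a} {c} {d} (p , _ , _ , desc , asc) 1≤a a≤c c≤d d≤k
  with ≤-total c p
... | inj₁ c≤p = m≤n⇒m≤n⊔o (at b d)
  (stepwise⇒mono _≥_ ≤-refl (flip ≤-trans) desc 1≤a (≤⇒≤′ a≤c) c≤p)
... | inj₂ p≤c = m≤n⇒m≤o⊔n (at b a)
  (stepwise⇒mono _≤_ ≤-refl ≤-trans asc p≤c (≤⇒≤′ c≤d) d≤k)

mirror≤ : ∀ {k} (b : Vec ℕ k) {j m} → VShaped k b → SDominating k b
  → 1 ≤ j → j ≤ m → 2 * m ≤ k → at b (k ∸ m + 1) ≤ at b j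
mirror≤ {k} b {j} {m} vShaped sDom 1≤j j≤m 2m≤k = begin
  at b (k ∸ m + 1)          ≤⟨ sDom m (≤-trans 1≤j j≤m) 2m≤k ⟩
  at b m                    ≤⟨ vShaped⇒quasiconvex b vShaped 1≤j j≤m m≤j′ j′≤k ⟩
  at b j ⊔ at b (k ∸ j + 1) ≤⟨ ⊔-lub ≤-refl (sDom j 1≤j 2j≤k) ⟩
  at b j                    ∎
  where
  open ≤-Reasoning
  2j≤k : 2 * j ≤ k
  2j≤k = ≤-trans (*-monoʳ-≤ 2 j≤m) 2m≤k
  m+j≤k : m + j ≤ k
  m+j≤k = ≤-trans (+-monoʳ-≤ m j≤m) (subst (_≤ k) (cong (m +_) (+-identityʳ m)) 2m≤k)
  m≤j′ : m ≤ k ∸ j + 1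
  m≤j′ = ≤-trans (m+n≤o⇒m≤o∸n m m+j≤k) (m≤m+n (k ∸ j) 1)
  j′≤k : k ∸ j + 1 ≤ k
  j′≤k = subst (k ∸ j + 1 ≤_) (m∸n+n≡m (≤-trans (m≤n+m j m) m+j≤k)) (+-monoʳ-≤ (k ∸ j) 1≤j)

mirror-involutive : ∀ {k x} → 1 ≤ x → x ≤ k → k ∸ (k ∸ x + 1) + 1 ≡ x
mirror-involutive {k} {x} 1≤x x≤k = begin
  k ∸ (k ∸ x + 1) + 1 ≡⟨ cong (_+ 1) (sym (∸-+-assoc k (k ∸ x) 1)) ⟩
  k ∸ (k ∸ x) ∸ 1 + 1 ≡⟨ cong (λ y → y ∸ 1 + 1) (m∸[m∸n]≡n x≤k) ⟩
  x ∸ 1 + 1           ≡⟨ m∸n+n≡m 1≤x ⟩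
  x                   ∎
  where open ≡-Reasoning

mirror-in-first-half : ∀ {h k l} → k ≡ 2 * h → k < 2 * l → l ≤ k → 2 * (k ∸ l + 1) ≤ k
mirror-in-first-half {h} {l = l} refl k<2l l≤k = begin
  2 * (2 * h ∸ l + 1)   ≡⟨ cong (2 *_) (+-comm (2 * h ∸ l) 1) ⟩
  2 * suc (2 * h ∸ l)   ≤⟨ *-monoʳ-≤ 2 (∸-monoʳ-< (*-cancelˡ-< 2 h l k<2l) l≤k) ⟩
  2 * (2 * h ∸ h)       ≡⟨ cong (2 *_) half ⟩
  2 * h                 ∎
  where
  open ≤-Reasoning
  half : 2 * h ∸ h ≡ h
  half = subst (λ y → h + y ∸ h ≡ h) (sym (+-identityʳ h)) (m+n∸m≡n h h)

powerOf2-even : ∀ {k} → IsPowerOf2 k → 2 ≤ k → ∃[ h ] k ≡ 2 * h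
powerOf2-even (zero , refl) (s≤s ())
powerOf2-even (suc m , refl) _ = 2 ^ m , refl

lemma3 : (k : ℕ) → 4 ≤ k → IsPowerOf2 k → (b : Vec ℕ k) → (i : ℕ)
    → VShapeSDominatingAt k b i
    → ∀ j l → 1 ≤ j → 4 * j ≤ k → k < 2 * l → 4 * l ≤ 3 * k
    → at b l ≤ at b j
lemma3 k 4≤k pow b i (vShaped , sDom , _) j l 1≤j 4j≤k k<2l 4l≤3k
  with powerOf2-even pow (≤-trans (s≤s (s≤s z≤n)) 4≤k)
... | h , k≡2h =
  subst (λ x → at b x ≤ at b j) (mirror-involutive 1≤l l≤k)
    (mirror≤ b vShaped sDom 1≤j j≤mirror (mirror-in-first-half {h} k≡2h k<2l l≤k))
  where
  l≤k : l ≤ k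
  l≤k = *-cancelˡ-≤ 4 (≤-trans 4l≤3k (*-monoˡ-≤ k (n≤1+n 3)))
  1≤l : 1 ≤ l
  1≤l = *-cancelˡ-< 2 0 l (≤-<-trans z≤n k<2l)
  j+l≤k : j + l ≤ k
  j+l≤k = *-cancelˡ-≤ 4 (subst (_≤ 4 * k) (sym (*-distribˡ-+ 4 j l)) (+-mono-≤ 4j≤k 4l≤3k))
  j≤mirror : j ≤ k ∸ l + 1
  j≤mirror = ≤-trans (m+n≤o⇒m≤o∸n j j+l≤k) (m≤m+n (k ∸ l) 1)
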